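{- Let $\Sigma=\{L,X,R\}$ with $L<_{\mathrm{lex}}X<_{\mathrm{lex}}R$, and let $\preceq$ be the relation on the set $\Sigma^*$ of finite words over $\Sigma$ defined by: $w\preceq w'$ iff $w=w'$ or there exists $0\le i<\min(|w|,|w'|)$ with $(w_i,w'_i)=(L,R)$ and $w_j\le_{\mathrm{lex}}w'_j$ for all $0\le j<i$. Let $W$ be an infinite-parameter word over $\Sigma$. Then for every $w,w'\in\Sigma^*$, $w\preceq w'$ if and only if $W(w)\preceq W(w')$.
   Context: An $\omega$-parameter (infinite-parameter) word over $\Sigma$ is an infinite string $W$ over $\Sigma\cup\{\lambda_i: i<\omega\}$ (new symbols called parameters) containing every $\lambda_i$, such that for every $j\ge1$ the first occurrence of $\lambda_j$ is after the first occurrence of $\lambda_{j-1}$. $W_j$ denotes the letter at index $j$ (indices start at $0$) and $|w|$ the length of a word $w$. For a finite word $w\in\Sigma^*$ of length $m$, $W(w)$ is the word obtained from $W$ by replacing each occurrence of $\lambda_i$, $0\le i<m$, by $w_i$ and truncating just before the first occurrence of $\lambda_m$ in $W$; it is a finite word over $\Sigma$. -}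

module Defs where

open import Data.Nat using (ℕ; zero; suc; _<_; _≟_)
open import Data.Bool using (Bool; true; false; if_then_else_)
open import Data.List using (List; []; _∷_; length; map; upTo)
open import Data.Maybe using (Maybe; just; nothing)
open import Data.Product using (Σ; ∃; _×_; _,_)
open import Data.Sum using (_⊎_)
open import Relation.Binary.PropositionalEquality using (_≡_)
open import Relation.Nullary.Decidable using (⌊_⌋)

data Letter : Set where
  L X R : Letter

data _≤lex_ : Letter → Letter → Set where
  L≤L : L ≤lex L
  L≤X : L ≤lex X
  L≤R : L ≤lex R
  X≤X : X ≤lex X
  X≤R : X ≤lex R
  R≤R : R ≤lex R

Word : Set
Word = List Letter

nth : {A : Set} → List A → ℕ → Maybe A
nth []       _       = nothing
nth (x ∷ xs) zero    = just x
nth (x ∷ xs) (suc i) = nth xs i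

_⪯_ : Word → Word → Set
w ⪯ w' = (w ≡ w') ⊎
  (Σ ℕ λ i → (nth w i ≡ just L) × (nth w' i ≡ just R) ×
     (∀ j a b → j < i → nth w j ≡ just a → nth w' j ≡ just b → a ≤lex b))

data Sym : Set where
  ltr : Letter → Sym
  par : ℕ → Sym     -- par i is the parameter λ_i

isPar : ℕ → Sym → Bool
isPar i (ltr _) = false
isPar i (par j) = ⌊ i ≟ j ⌋

-- ω-parameter word: an infinite string over Σ ∪ {λ_i} containing every λ_i,
-- such that for j ≥ 1 the first occurrence of λ_j is after the first
-- occurrence of λ_{j-1} (equivalently: every occurrence of λ_{j+1} is
-- preceded by some occurrence of λ_j).
record OmegaParamWord : Set where
  field
    sym      : ℕ → Sym
    occurs   : ∀ i → ∃ λ k → sym k ≡ par i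
    ordered  : ∀ j k → sym k ≡ par (suc j) → ∃ λ k' → k' < k × sym k' ≡ par j
open OmegaParamWord public

-- least index i ≤ n with P i = true (returns n if there is none below n;
-- when P n = true this is the least i with P i = true)
least : (ℕ → Bool) → ℕ → ℕ
least P zero    = zero
least P (suc n) = if P zero then zero else suc (least (λ i → P (suc i)) n)

firstOcc : OmegaParamWord → ℕ → ℕ
firstOcc W m with occurs W m
... | k , _ = least (λ i → isPar m (sym W i)) k

-- substitute: letters stay, λ_i becomes w_i (the default L is never used,
-- since only λ_i with i < |w| occur before the first λ_{|w|})
substSym : Word → Sym → Letter
substSym w (ltr a) = a
substSym w (par i) with nth w i
... | just a  = a
... | nothing = L

apply : OmegaParamWord → Word → Word
apply W w = map (λ j → substSym w (sym W j)) (upTo (firstOcc W (length w)))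

-- In W(w) the position firstOcc W t carries w_t, and every position before
-- firstOcc W t carries either a constant letter (the same in W(w) and W(w'))
-- or a parameter λ_s with s < t (carrying w_s resp. w'_s). So an L/R witness
-- i for w ⪯ w' moves to the witness firstOcc W i for W(w) ⪯ W(w'). Conversely
-- a witness position of W(w) ⪯ W(w') cannot hold a constant letter, so it holds
-- some λ_t, and t is a witness for w ⪯ w', its prefix condition being read off
-- at the positions firstOcc W j < firstOcc W t. Finally W(-) is injective
-- because w_t is read off at position firstOcc W t.
module Submission where

open import Defs
open import Function using (_∘_)
open import Function.Bundles using (_⇔_; mk⇔)
open import Data.Nat using (ℕ; zero; suc; _<_; _≤_; _≤′_; ≤′-refl; ≤′-step; _≟_; s≤s; z<s)
open import Data.Nat.Properties
  using (≤⇒≤′; ≤-<-trans; <⇒≤; <⇒≱; ≮⇒≥; ≰⇒>; ≤∧≢⇒<; <-irrefl; <-≤-trans; ≤-refl)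
open import Data.Bool using (Bool; true; false)
open import Data.List using (List; []; _∷_; length; map; upTo; applyUpTo)
open import Data.List.Properties using (length-map; length-upTo)
open import Data.Maybe using (just)
import Data.Maybe as Maybe
open import Data.Maybe.Properties using (just-injective)
open import Data.Product using (∃; _,_)
open import Data.Sum using (inj₁; inj₂)
open import Relation.Nullary using (yes; no; contradiction)
open import Relation.Binary.PropositionalEquality
  using (_≡_; _≢_; refl; cong; cong₂; trans; subst; module ≡-Reasoning)
  renaming (sym to ≡-sym)

least-satisfies : ∀ (P : ℕ → Bool) n → P n ≡ true → P (least P n) ≡ true
least-satisfies P zero    Pn = Pn
least-satisfies P (suc n) Pn with P zero in P0
... | true  = P0
... | false = least-satisfies (λ i → P (suc i)) n Pn

least-minimal : ∀ (P : ℕ → Bool) n {i} → i < least P n → P i ≡ false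
least-minimal P (suc n) {i} i<least with P zero in P0
least-minimal P (suc n) {zero}  i<least       | false = P0
least-minimal P (suc n) {suc i} (s≤s i<least) | false =
  least-minimal (λ i → P (suc i)) n i<least

isPar-sound : ∀ m s → isPar m s ≡ true → s ≡ par m
isPar-sound m (par j) _ with m ≟ j
... | yes refl = refl

isPar-complete : ∀ {m s} → s ≡ par m → isPar m s ≡ true
isPar-complete {m} refl with m ≟ m
... | yes _   = refl
... | no m≢m = contradiction refl m≢m

par-injective : ∀ {i j} → par i ≡ par j → i ≡ j
par-injective refl = refl

≤lex-refl : ∀ a → a ≤lex a
≤lex-refl L = L≤L
≤lex-refl X = X≤X
≤lex-refl R = R≤R

nth-map : ∀ {A B : Set} (h : A → B) xs k → nth (map h xs) k ≡ Maybe.map h (nth xs k)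
nth-map h []       k       = refl
nth-map h (x ∷ xs) zero    = refl
nth-map h (x ∷ xs) (suc k) = nth-map h xs k

nth-applyUpTo : ∀ {A : Set} (f : ℕ → A) {n k} → k < n → nth (applyUpTo f n) k ≡ just (f k)
nth-applyUpTo f {suc n} {zero}  k<n       = refl
nth-applyUpTo f {suc n} {suc k} (s≤s k<n) = nth-applyUpTo (λ i → f (suc i)) k<n

nth-just⇒< : ∀ {A : Set} (xs : List A) k {a} → nth xs k ≡ just a → k < length xs
nth-just⇒< (x ∷ xs) zero    _ = z<s
nth-just⇒< (x ∷ xs) (suc k) e = s≤s (nth-just⇒< xs k e)

nth-<⇒just : ∀ {A : Set} (xs : List A) {k} → k < length xs → ∃ λ a → nth xs k ≡ just a
nth-<⇒just (x ∷ xs) {zero}  _         = x , refl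
nth-<⇒just (x ∷ xs) {suc k} (s≤s k<n) = nth-<⇒just xs k<n

nth-just-ext : ∀ {A : Set} (xs ys : List A) →
               (∀ k {a} → nth xs k ≡ just a → nth ys k ≡ just a) →
               (∀ k {a} → nth ys k ≡ just a → nth xs k ≡ just a) → xs ≡ ys
nth-just-ext []       []       _     _     = refl
nth-just-ext []       (y ∷ ys) _     ys⊆xs with () ← ys⊆xs zero refl
nth-just-ext (x ∷ xs) []       xs⊆ys _     with () ← xs⊆ys zero refl
nth-just-ext (x ∷ xs) (y ∷ ys) xs⊆ys ys⊆xs =
  cong₂ _∷_ (just-injective (ys⊆xs zero refl))
            (nth-just-ext xs ys (λ k → xs⊆ys (suc k)) (λ k → ys⊆xs (suc k)))

substSym-par : ∀ w {t a} → nth w t ≡ just a → substSym w (par t) ≡ a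
substSym-par w {t} e with nth w t
... | just b = just-injective e

module _ (W : OmegaParamWord) where

  firstOcc-par : ∀ m → sym W (firstOcc W m) ≡ par m
  firstOcc-par m with occurs W m
  ... | k , symk≡par = isPar-sound m _ (least-satisfies (λ i → isPar m (sym W i)) k
                         (isPar-complete symk≡par))

  firstOcc-minimal : ∀ {m k} → k < firstOcc W m → sym W k ≢ par m
  firstOcc-minimal {m} {k} k<first symk≡par with occurs W m
  ... | k₀ , _ with () ← trans (≡-sym (least-minimal (λ i → isPar m (sym W i)) k₀ k<first))
                               (isPar-complete symk≡par)

  firstOcc-≤′ : ∀ {m j k} → m ≤′ j → sym W k ≡ par j → firstOcc W m ≤ k
  firstOcc-≤′ ≤′-refl symk≡par = ≮⇒≥ (λ k<first → firstOcc-minimal k<first symk≡par)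
  firstOcc-≤′ {j = suc j} {k} (≤′-step m≤′j) symk≡par with ordered W j k symk≡par
  ... | k′ , k′<k , symk′≡par = <⇒≤ (≤-<-trans (firstOcc-≤′ m≤′j symk′≡par) k′<k)

  firstOcc-≤ : ∀ {m j k} → m ≤ j → sym W k ≡ par j → firstOcc W m ≤ k
  firstOcc-≤ m≤j = firstOcc-≤′ (≤⇒≤′ m≤j)

  firstOcc-strictMono : ∀ {j m} → j < m → firstOcc W j < firstOcc W m
  firstOcc-strictMono {j} {m} j<m = ≤∧≢⇒< (firstOcc-≤ (<⇒≤ j<m) (firstOcc-par m)) firstOcc≢
    where
    firstOcc≢ : firstOcc W j ≢ firstOcc W m
    firstOcc≢ e = <-irrefl (par-injective (trans (≡-sym (firstOcc-par j))
                                                  (trans (cong (sym W) e) (firstOcc-par m)))) j<m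

  par-before-firstOcc : ∀ {m j k} → sym W k ≡ par j → k < firstOcc W m → j < m
  par-before-firstOcc symk≡par k<first = ≰⇒> (λ m≤j → <⇒≱ k<first (firstOcc-≤ m≤j symk≡par))

  nth-apply : ∀ w {k} → k < firstOcc W (length w) →
              nth (apply W w) k ≡ just (substSym w (sym W k))
  nth-apply w {k} k<first =
    trans (nth-map letterAt (upTo n) k) (cong (Maybe.map letterAt) (nth-applyUpTo (λ j → j) {n} k<first))
    where
    n : ℕ
    n = firstOcc W (length w)
    letterAt : ℕ → Letter
    letterAt j = substSym w (sym W j)

  length-apply : ∀ w → length (apply W w) ≡ firstOcc W (length w)
  length-apply w = trans (length-map (λ j → substSym w (sym W j)) (upTo n)) (length-upTo n)
    where
    n : ℕ
    n = firstOcc W (length w)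

  nth-apply-just⇒< : ∀ w {k a} → nth (apply W w) k ≡ just a → k < firstOcc W (length w)
  nth-apply-just⇒< w {k} e = subst (k <_) (length-apply w) (nth-just⇒< (apply W w) k e)

  nth-apply-firstOcc : ∀ w {t a} → nth w t ≡ just a → nth (apply W w) (firstOcc W t) ≡ just a
  nth-apply-firstOcc w {t} {a} wt≡a = begin
    nth (apply W w) (firstOcc W t)           ≡⟨ nth-apply w (firstOcc-strictMono (nth-just⇒< w t wt≡a)) ⟩
    just (substSym w (sym W (firstOcc W t))) ≡⟨ cong (just ∘ substSym w) (firstOcc-par t) ⟩
    just (substSym w (par t))                ≡⟨ cong just (substSym-par w wt≡a) ⟩
    just a                                   ∎
    where open ≡-Reasoning

  nth-apply-ltr : ∀ w {k c a} → sym W k ≡ ltr c → nth (apply W w) k ≡ just a → a ≡ c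
  nth-apply-ltr w {k} {c} {a} symk≡c e = just-injective (begin
    just a                      ≡⟨ e ⟨
    nth (apply W w) k           ≡⟨ nth-apply w (nth-apply-just⇒< w e) ⟩
    just (substSym w (sym W k)) ≡⟨ cong (just ∘ substSym w) symk≡c ⟩
    just c                      ∎)
    where open ≡-Reasoning

  nth-apply-par : ∀ w {k t a} → sym W k ≡ par t → nth (apply W w) k ≡ just a → nth w t ≡ just a
  nth-apply-par w {k} {t} {a} symk≡t e
    with b , wt≡b ← nth-<⇒just w (par-before-firstOcc symk≡t (nth-apply-just⇒< w e)) = begin
    nth w t                     ≡⟨ wt≡b ⟩
    just b                      ≡⟨ cong just (substSym-par w wt≡b) ⟨
    just (substSym w (par t))   ≡⟨ cong (just ∘ substSym w) symk≡t ⟨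
    just (substSym w (sym W k)) ≡⟨ nth-apply w (nth-apply-just⇒< w e) ⟨
    nth (apply W w) k           ≡⟨ e ⟩
    just a                      ∎
    where open ≡-Reasoning

  apply-injective : ∀ {w w'} → apply W w ≡ apply W w' → w ≡ w'
  apply-injective {w} {w'} e = nth-just-ext w w' (transport e) (transport (≡-sym e))
    where
    transport : ∀ {u v} → apply W u ≡ apply W v → ∀ t {a} → nth u t ≡ just a → nth v t ≡ just a
    transport {u} {v} e t {a} ut≡a = nth-apply-par v (firstOcc-par t)
      (subst (λ x → nth x (firstOcc W t) ≡ just a) e (nth-apply-firstOcc u ut≡a))

  apply-mono-⪯ : ∀ {w w'} → w ⪯ w' → apply W w ⪯ apply W w'
  apply-mono-⪯ (inj₁ refl) = inj₁ refl
  apply-mono-⪯ {w} {w'} (inj₂ (i , wi≡L , w'i≡R , below-i)) =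
    inj₂ (firstOcc W i , nth-apply-firstOcc w wi≡L , nth-apply-firstOcc w' w'i≡R , below-firstOcc)
    where
    below-firstOcc : ∀ k a b → k < firstOcc W i →
                     nth (apply W w) k ≡ just a → nth (apply W w') k ≡ just b → a ≤lex b
    below-firstOcc k a b k<first ak≡a a'k≡b with sym W k in symk
    ... | ltr c rewrite nth-apply-ltr w symk ak≡a | nth-apply-ltr w' symk a'k≡b = ≤lex-refl c
    ... | par t = below-i t a b (par-before-firstOcc symk k<first)
                    (nth-apply-par w symk ak≡a) (nth-apply-par w' symk a'k≡b)

  apply-reflects-⪯ : ∀ {w w'} → apply W w ⪯ apply W w' → w ⪯ w'
  apply-reflects-⪯ (inj₁ e) = inj₁ (apply-injective e)
  apply-reflects-⪯ {w} {w'} (inj₂ (k , ak≡L , a'k≡R , below-k)) with sym W k in symk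
  ... | ltr c = contradiction (trans (nth-apply-ltr w symk ak≡L) (≡-sym (nth-apply-ltr w' symk a'k≡R))) λ ()
  ... | par t = inj₂ (t , nth-apply-par w symk ak≡L , nth-apply-par w' symk a'k≡R , below-t)
    where
    below-t : ∀ j a b → j < t → nth w j ≡ just a → nth w' j ≡ just b → a ≤lex b
    below-t j a b j<t wj≡a w'j≡b =
      below-k (firstOcc W j) a b (<-≤-trans (firstOcc-strictMono j<t) (firstOcc-≤ ≤-refl symk))
        (nth-apply-firstOcc w wj≡a) (nth-apply-firstOcc w' w'j≡b)

lemma4p8 : (W : OmegaParamWord) (w w' : Word) → (w ⪯ w') ⇔ (apply W w ⪯ apply W w')
lemma4p8 W w w' = mk⇔ (apply-mono-⪯ W) (apply-reflects-⪯ W)
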